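{- For all $r_1,r_2\in\mathbb{N}$ with $r_2>2$, the number $R(r_1,r_2)=2\cdot 3^{r_1}\cdot 5^{r_2}$ lies in $N_2$.
   Context: $\phi$ is Euler's totient function, $V=\phi(\mathbb{N})$, $N_2(m)=\max\{x\in\mathbb{N}\colon\phi(x)=m\}$ for $m\in V$, and $N_2=\{N_2(m)\colon m\in V\}$. -}

module Defs where

open import Data.Nat using (ℕ; zero; suc; _≤_; _≟_)
open import Data.Nat.GCD using (gcd)
open import Data.List using (List; filter; length)
open import Data.List using (upTo)
open import Data.Nat.Base using (_+_)
open import Data.Product using (Σ; _×_)
open import Relation.Binary.PropositionalEquality using (_≡_)

-- Euler's totient: φ n = #{ k : 1 ≤ k ≤ n , gcd k n = 1 }  (so φ 0 = 0, φ 1 = 1)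
φ : ℕ → ℕ
φ n = length (filter (λ k → gcd (suc k) n ≟ 1) (upTo n))

-- Positive naturals (ℕ = {1,2,3,...} in the paper)
IsPos : ℕ → Set
IsPos n = 1 ≤ n

InV : ℕ → Set
InV m = Σ ℕ λ x → IsPos x × φ x ≡ m

IsN₂Of : ℕ → ℕ → Set
IsN₂Of m N = IsPos N × φ N ≡ m × (∀ x → IsPos x → φ x ≡ m → x ≤ N)

InN₂ : ℕ → Set
InN₂ N = Σ ℕ λ m → InV m × IsN₂Of m N

-- Let N = 2·3^(a+1)·5^(c+1) with c ≥ 2. Then φ(N) = 8·3^a·5^c, so N/φ(N) = 15/4, and every x with
-- φ(x) = φ(N) has 16 ∤ φ(x) and 25 ∣ φ(x). These two conditions alone force x/φ(x) ≤ 15/4, so x ≤ N.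
-- Write x = 2^α·3^β·5^γ·w with w free of prime factors below 7. A prime p ∈ {2, 3, 5} dividing x
-- multiplies x/φ(x) by p/(p−1) and contributes p − 1 to φ(x), using 0, 1 or 2 of its at most three factors 2.
-- A prime p ≥ 7 dividing w multiplies w/φ(w) by at most 7/6 but uses up a factor 2 of φ(w), and if it
-- also supplies a factor 5 or 25 of φ(w) then p ≥ 11 or p ≥ 51. This bounds w/φ(w) in terms of the
-- remaining 2-adic room and the factor 25 still needed, by induction on the prime factorisation of w.

module Submission where

open import Defs
open import Data.Nat.Base
open import Data.Nat.Properties
open import Data.Nat.Divisibility
open import Data.Nat.GCD using (gcd)
open import Data.Nat.Coprimality as Coprime
  using (Coprime; coprime?; coprime-divisor; coprime-+; gcd≡1⇒coprime; coprime⇒gcd≡1)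
open import Data.Nat.Primality
  using (Prime; prime?; prime[2]; prime⇒irreducible; prime⇒nonTrivial; prime⇒nonZero; euclidsLemma;
         _Rough_; 2-rough; rough⇒≤; rough∧∣⇒rough; ∤⇒rough-suc)
open import Data.Nat.Primality.Factorisation using (factorise)
open import Data.Nat.ListAction using (product)
open import Data.List.Relation.Unary.All using (All; []; _∷_)
open import Data.List.Base using ([]; _∷_; filter; length; applyUpTo)
open import Data.Product.Base using (_×_; _,_; proj₁; proj₂; ∃₂)
open import Data.Sum.Base using (_⊎_; inj₁; inj₂)
open import Function.Base using (_∘_; id; flip)
open import Relation.Nullary using (Dec; yes; no; ¬_; contradiction)
open import Relation.Nullary.Decidable using (True; toWitness; from-yes; from-no)
open import Relation.Unary using (Decidable)
open import Relation.Binary.PropositionalEquality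
open import Data.Nat.Tactic.RingSolver using (solve-∀)
open import Algebra.Properties.CommutativeSemigroup +-commutativeSemigroup
  using () renaming (interchange to +-interchange)

∑< : ℕ → (ℕ → ℕ) → ℕ
∑< zero    h = 0
∑< (suc n) h = h 0 + ∑< n (h ∘ suc)

syntax ∑< n (λ i → e) = ∑[ i < n ] e

∑-cong : ∀ n {g h : ℕ → ℕ} → (∀ i → i < n → g i ≡ h i) → ∑< n g ≡ ∑< n h
∑-cong zero    g≗h = refl
∑-cong (suc n) g≗h = cong₂ _+_ (g≗h 0 z<s) (∑-cong n (λ i i<n → g≗h (suc i) (s<s i<n)))

∑-zero : ∀ n {h : ℕ → ℕ} → (∀ i → i < n → h i ≡ 0) → ∑< n h ≡ 0
∑-zero zero    h≗0 = refl
∑-zero (suc n) h≗0 = cong₂ _+_ (h≗0 0 z<s) (∑-zero n (λ i i<n → h≗0 (suc i) (s<s i<n)))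

∑-+ : ∀ m n (h : ℕ → ℕ) → ∑< (m + n) h ≡ ∑< m h + ∑[ i < n ] h (m + i)
∑-+ zero    n h = refl
∑-+ (suc m) n h = trans (cong (h 0 +_) (∑-+ m n (h ∘ suc))) (sym (+-assoc (h 0) _ _))

∑-last : ∀ n (h : ℕ → ℕ) → ∑< (suc n) h ≡ ∑< n h + h n
∑-last zero    h = +-comm (h 0) 0
∑-last (suc n) h = trans (cong (h 0 +_) (∑-last n (h ∘ suc))) (sym (+-assoc (h 0) _ _))

∑-distrib-+ : ∀ n (g h : ℕ → ℕ) → ∑[ i < n ] (g i + h i) ≡ ∑< n g + ∑< n h
∑-distrib-+ zero    g h = refl
∑-distrib-+ (suc n) g h =
  trans (cong (g 0 + h 0 +_) (∑-distrib-+ n (g ∘ suc) (h ∘ suc)))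
        (+-interchange (g 0) (h 0) (∑< n (g ∘ suc)) (∑< n (h ∘ suc)))

∑-periodic : ∀ z (h : ℕ → ℕ) → (∀ i → h (z + i) ≡ h i) → ∀ p → ∑< (p * z) h ≡ p * ∑< z h
∑-periodic z h periodic zero    = refl
∑-periodic z h periodic (suc p) =
  trans (∑-+ z (p * z) h)
        (cong (∑< z h +_) (trans (∑-cong (p * z) (λ i _ → periodic i)) (∑-periodic z h periodic p)))

𝟙 : {A : Set} → Dec A → ℕ
𝟙 (yes _) = 1
𝟙 (no _)  = 0

𝟙-yes : {A : Set} → A → (a? : Dec A) → 𝟙 a? ≡ 1
𝟙-yes a (yes _) = refl
𝟙-yes a (no ¬a) = contradiction a ¬a

𝟙-no : {A : Set} → ¬ A → (a? : Dec A) → 𝟙 a? ≡ 0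
𝟙-no ¬a (yes a) = contradiction a ¬a
𝟙-no ¬a (no _)  = refl

𝟙-cong : {A B : Set} → (A → B) → (B → A) → (a? : Dec A) (b? : Dec B) → 𝟙 a? ≡ 𝟙 b?
𝟙-cong A→B B→A (yes a) b? = sym (𝟙-yes (A→B a) b?)
𝟙-cong A→B B→A (no ¬a) b? = sym (𝟙-no (¬a ∘ B→A) b?)

length-filter-applyUpTo : ∀ {P : ℕ → Set} (P? : Decidable P) (f : ℕ → ℕ) n →
                          length (filter P? (applyUpTo f n)) ≡ ∑[ i < n ] 𝟙 (P? (f i))
length-filter-applyUpTo P? f zero = refl
length-filter-applyUpTo P? f (suc n) with P? (f 0)
... | yes _ = cong suc (length-filter-applyUpTo P? (f ∘ suc) n)
... | no _  = length-filter-applyUpTo P? (f ∘ suc) n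

prime[3] : Prime 3
prime[3] = from-yes (prime? 3)

prime[5] : Prime 5
prime[5] = from-yes (prime? 5)

prime≢1 : ∀ {p} → Prime p → p ≢ 1
prime≢1 p-prime refl = contradiction (prime⇒nonTrivial p-prime) λ ()

prime∣prime⇒≡ : ∀ {p q} → Prime p → Prime q → p ∣ q → p ≡ q
prime∣prime⇒≡ p-prime q-prime p∣q with prime⇒irreducible q-prime p∣q
... | inj₁ p≡1 = contradiction p≡1 (prime≢1 p-prime)
... | inj₂ p≡q = p≡q

coprime-∣ʳ : ∀ {a n d} → Coprime a n → d ∣ n → Coprime a d
coprime-∣ʳ a⊥n d∣n (i∣a , i∣d) = a⊥n (i∣a , ∣-trans i∣d d∣n)

coprime-*ʳ : ∀ {a b c} → Coprime a b → Coprime a c → Coprime a (b * c)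
coprime-*ʳ {a} {b} a⊥b a⊥c (i∣a , i∣bc) = a⊥c (i∣a , coprime-divisor i⊥b i∣bc)
  where
  i⊥b : Coprime _ b
  i⊥b (j∣i , j∣b) = a⊥b (∣-trans j∣i i∣a , j∣b)

coprime-^ʳ : ∀ {a b} → Coprime a b → ∀ k → Coprime a (b ^ k)
coprime-^ʳ a⊥b zero    (_ , i∣1) = ∣1⇒≡1 i∣1
coprime-^ʳ a⊥b (suc k) = coprime-*ʳ a⊥b (coprime-^ʳ a⊥b k)

coprime-+ˡ⁻¹ : ∀ {z b} → Coprime (z + b) z → Coprime b z
coprime-+ˡ⁻¹ zb⊥z (i∣b , i∣z) = zb⊥z (∣m∣n⇒∣m+n i∣z i∣b , i∣z)

prime∤⇒coprime : ∀ {p a} → Prime p → p ∤ a → Coprime p a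
prime∤⇒coprime p-prime p∤a (i∣p , i∣a) with prime⇒irreducible p-prime i∣p
... | inj₁ i≡1 = i≡1
... | inj₂ refl = contradiction i∣a p∤a

prime∤⇒coprime-^ : ∀ {p n} → Prime p → p ∤ n → ∀ k → Coprime (p ^ k) n
prime∤⇒coprime-^ p-prime p∤n k = Coprime.sym (coprime-^ʳ (Coprime.sym (prime∤⇒coprime p-prime p∤n)) k)

prime∤⇒∤^ : ∀ {p n} → Prime p → p ∤ n → ∀ k → p ∤ n ^ k
prime∤⇒∤^ p-prime p∤n k p∣n^k = prime≢1 p-prime (coprime-^ʳ (prime∤⇒coprime p-prime p∤n) k (∣-refl , p∣n^k))

prime-square∣*⇒∣ : ∀ {p q f} → Prime p → p ∣ q → p * p ∤ q → p * p ∣ q * f → p ∣ f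
prime-square∣*⇒∣ {p} {_} {f} p-prime (divides u refl) p²∤up p²∣upf
  with euclidsLemma u f p-prime p∣uf
  where
  p∣uf : p ∣ u * f
  p∣uf = *-cancelˡ-∣ p {{prime⇒nonZero p-prime}} (subst (p * p ∣_) (x*y*z≡y*[x*z] u p f) p²∣upf)
    where
    x*y*z≡y*[x*z] : ∀ x y z → x * y * z ≡ y * (x * z)
    x*y*z≡y*[x*z] = solve-∀
... | inj₁ p∣u = contradiction (*-monoˡ-∣ p p∣u) p²∤up
... | inj₂ p∣f = p∣f

2∣n⊎2∣1+n : ∀ n → 2 ∣ n ⊎ 2 ∣ suc n
2∣n⊎2∣1+n zero    = inj₁ (2 ∣0)
2∣n⊎2∣1+n (suc n) with 2∣n⊎2∣1+n n
... | inj₁ 2∣n   = inj₂ (∣m∣n⇒∣m+n ∣-refl 2∣n)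
... | inj₂ 2∣1+n = inj₁ 2∣1+n

6≤n∧5∣n⇒10≤n : ∀ {n} → 6 ≤ n → 5 ∣ n → 10 ≤ n
6≤n∧5∣n⇒10≤n 6≤0 (divides 0 refl)                = contradiction 6≤0 (from-no (6 ≤? 0))
6≤n∧5∣n⇒10≤n 6≤5 (divides 1 refl)                = contradiction 6≤5 (from-no (6 ≤? 5))
6≤n∧5∣n⇒10≤n _   (divides (suc (suc u)) refl) = m≤m+n 10 (u * 5)

6≤n∧2∣n∧25∣n⇒50≤n : ∀ {n} → 6 ≤ n → 2 ∣ n → 25 ∣ n → 50 ≤ n
6≤n∧2∣n∧25∣n⇒50≤n 6≤0 _    (divides 0 refl)              = contradiction 6≤0 (from-no (6 ≤? 0))
6≤n∧2∣n∧25∣n⇒50≤n _   2∣25 (divides 1 refl)              = contradiction 2∣25 (from-no (2 ∣? 25))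
6≤n∧2∣n∧25∣n⇒50≤n _   _    (divides (suc (suc u)) refl) = m≤m+n 50 (u * 25)

rough⇒∤ : ∀ {m n d} .{{_ : NonTrivial d}} → m Rough n → d < m → d ∤ n
rough⇒∤ m-rough d<m d∣n = m-rough (hasNonTrivialDivisor d<m d∣n)

3-rough⇒5-rough : ∀ {n} → 3 Rough n → 3 ∤ n → 5 Rough n
3-rough⇒5-rough 3-rough 3∤n = ∤⇒rough-suc 4∤n (∤⇒rough-suc 3∤n 3-rough)
  where
  4∤n : 4 ∤ _
  4∤n 4∣n = rough⇒∤ 3-rough (from-yes (2 <? 3)) (∣-trans (divides 2 refl) 4∣n)

5-rough⇒7-rough : ∀ {n} → 5 Rough n → 5 ∤ n → 7 Rough n
5-rough⇒7-rough 5-rough 5∤n = ∤⇒rough-suc 6∤n (∤⇒rough-suc 5∤n 5-rough)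
  where
  6∤n : 6 ∤ _
  6∤n 6∣n = rough⇒∤ 5-rough (from-yes (2 <? 5)) (∣-trans (divides 3 refl) 6∣n)

product-prime-power-split : ∀ {p} → Prime p → ∀ ps → All Prime ps → ∃₂ λ k w → product ps ≡ p ^ k * w × p ∤ w
product-prime-power-split p-prime []       []                  = 0 , 1 , refl , λ p∣1 → prime≢1 p-prime (∣1⇒≡1 p∣1)
product-prime-power-split {p} p-prime (q ∷ ps) (q-prime ∷ ps-prime)
  with product-prime-power-split p-prime ps ps-prime | q ≟ p
... | k , w , eq , p∤w | yes refl = suc k , w , trans (cong (q *_) eq) (sym (*-assoc q (q ^ k) w)) , p∤w
... | k , w , eq , p∤w | no q≢p   = k , q * w , trans (cong (q *_) eq) (x*[y*z]≡y*[x*z] q (p ^ k) w) , p∤qw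
  where
  x*[y*z]≡y*[x*z] : ∀ x y z → x * (y * z) ≡ y * (x * z)
  x*[y*z]≡y*[x*z] = solve-∀
  p∤qw : p ∤ q * w
  p∤qw p∣qw with euclidsLemma q w p-prime p∣qw
  ... | inj₁ p∣q = q≢p (sym (prime∣prime⇒≡ p-prime q-prime p∣q))
  ... | inj₂ p∣w = p∤w p∣w

prime-power-split : ∀ {p} → Prime p → ∀ x .{{_ : NonZero x}} → p ∤ x ⊎ ∃₂ λ k w → x ≡ p ^ suc k * w × p ∤ w
prime-power-split {p} p-prime x with factorise x
... | record { factors = ps ; isFactorisation = x≡∏ps ; factorsPrime = ps-prime }
  with product-prime-power-split p-prime ps ps-prime
... | zero  , w , ∏ps≡w , p∤w = inj₁ (λ p∣x → p∤w (subst (p ∣_) (trans x≡∏ps (trans ∏ps≡w (*-identityˡ w))) p∣x))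
... | suc k , w , ∏ps≡p^kw , p∤w = inj₂ (k , w , trans x≡∏ps ∏ps≡p^kw , p∤w)

-- The totient of a product with a prime

φ≡∑coprime : ∀ n → φ n ≡ ∑[ i < n ] 𝟙 (coprime? (suc i) n)
φ≡∑coprime n = trans (length-filter-applyUpTo (λ k → gcd (suc k) n ≟ 1) id n)
                     (∑-cong n (λ i _ → 𝟙-cong gcd≡1⇒coprime coprime⇒gcd≡1 _ _))

∑coprime-periodic : ∀ p z → ∑[ i < p * z ] 𝟙 (coprime? (suc i) z) ≡ p * φ z
∑coprime-periodic p z = trans (∑-periodic z _ periodic p) (cong (p *_) (sym (φ≡∑coprime z)))
  where
  periodic : ∀ i → 𝟙 (coprime? (suc (z + i)) z) ≡ 𝟙 (coprime? (suc i) z)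
  periodic i = trans (cong (λ a → 𝟙 (coprime? a z)) (sym (+-suc z i))) (𝟙-cong coprime-+ˡ⁻¹ coprime-+ _ _)

φ-*-∣ : ∀ p z → p ∣ z → φ (p * z) ≡ p * φ z
φ-*-∣ p z p∣z = begin
  φ (p * z)                                    ≡⟨ φ≡∑coprime (p * z) ⟩
  ∑[ i < p * z ] 𝟙 (coprime? (suc i) (p * z))  ≡⟨ ∑-cong (p * z) (λ i _ → 𝟙-cong restrict extend _ _) ⟩
  ∑[ i < p * z ] 𝟙 (coprime? (suc i) z)        ≡⟨ ∑coprime-periodic p z ⟩
  p * φ z                                      ∎
  where
  open ≡-Reasoning
  restrict : ∀ {a} → Coprime a (p * z) → Coprime a z
  restrict a⊥pz = coprime-∣ʳ a⊥pz (n∣m*n p)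
  extend : ∀ {a} → Coprime a z → Coprime a (p * z)
  extend a⊥z = coprime-*ʳ (coprime-∣ʳ a⊥z p∣z) a⊥z

∑-multiples : ∀ q (g : ℕ → ℕ) n →
              ∑[ i < n * suc q ] (𝟙 (suc q ∣? suc i) * g (suc i)) ≡ ∑[ j < n ] g (suc j * suc q)
∑-multiples q g zero    = refl
∑-multiples q g (suc n) = begin
  ∑< (p + n * p) f                            ≡⟨ ∑-+ p (n * p) f ⟩
  ∑< p f + ∑[ i < n * p ] f (p + i)           ≡⟨ cong₂ _+_ first-block (∑-cong (n * p) shift) ⟩
  g (p + 0) + ∑[ i < n * p ] (𝟙 (p ∣? suc i) * g (p + suc i))
                                              ≡⟨ cong (g (p + 0) +_) (∑-multiples q (λ x → g (p + x)) n) ⟩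
  g (p + 0) + ∑[ j < n ] g (p + suc j * p)    ∎
  where
  open ≡-Reasoning
  p = suc q
  f : ℕ → ℕ
  f i = 𝟙 (p ∣? suc i) * g (suc i)
  first-block : ∑< p f ≡ g (p + 0)
  first-block = begin
    ∑< p f       ≡⟨ ∑-last q f ⟩
    ∑< q f + f q ≡⟨ cong₂ _+_ (∑-zero q (λ i i<q → cong (_* g (suc i)) (𝟙-no (p∤1+i i<q) (p ∣? suc i))))
                              (cong (_* g p) (𝟙-yes ∣-refl (p ∣? p))) ⟩
    g p + 0      ≡⟨ +-identityʳ (g p) ⟩
    g p          ≡⟨ cong g (+-identityʳ p) ⟨
    g (p + 0)    ∎
    where
    p∤1+i : ∀ {i} → i < q → p ∤ suc i
    p∤1+i i<q p∣1+i = <⇒≱ (s<s i<q) (∣⇒≤ p∣1+i)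
  shift : ∀ i → i < n * p → f (p + i) ≡ 𝟙 (p ∣? suc i) * g (p + suc i)
  shift i _ = begin
    𝟙 (p ∣? suc (p + i)) * g (suc (p + i)) ≡⟨ cong (λ a → 𝟙 (p ∣? a) * g a) (+-suc p i) ⟨
    𝟙 (p ∣? p + suc i) * g (p + suc i)     ≡⟨ cong (_* g (p + suc i)) (𝟙-cong (flip ∣m+n∣m⇒∣n ∣-refl) (∣m∣n⇒∣m+n ∣-refl)
                                                                             (p ∣? p + suc i) (p ∣? suc i)) ⟩
    𝟙 (p ∣? suc i) * g (p + suc i)         ∎

coprime-prime*-split : ∀ {p z} → Prime p → p ∤ z → ∀ a →
                       𝟙 (coprime? a (p * z)) + 𝟙 (p ∣? a) * 𝟙 (coprime? a z) ≡ 𝟙 (coprime? a z)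
coprime-prime*-split {p} {z} p-prime p∤z a with coprime? a z | p ∣? a
... | no ¬a⊥z | p∣?a =
  cong₂ _+_ (𝟙-no (λ (a⊥pz : Coprime a (p * z)) → ¬a⊥z (coprime-∣ʳ a⊥pz (n∣m*n p))) (coprime? a (p * z)))
            (*-zeroʳ (𝟙 p∣?a))
... | yes a⊥z | yes p∣a =
  cong (_+ 1) (𝟙-no (λ (a⊥pz : Coprime a (p * z)) → prime≢1 p-prime (a⊥pz (p∣a , m∣m*n z))) (coprime? a (p * z)))
... | yes a⊥z | no p∤a =
  cong (_+ 0) (𝟙-yes {Coprime a (p * z)} (coprime-*ʳ (Coprime.sym (prime∤⇒coprime p-prime p∤a)) a⊥z)
                     (coprime? a (p * z)))

-- The numbers up to p z coprime to z are those coprime to p z together with p times those up to z coprime to z.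
φ-prime* : ∀ q z → Prime (suc q) → suc q ∤ z → φ (suc q * z) ≡ q * φ z
φ-prime* q z p-prime p∤z = +-cancelʳ-≡ (φ z) (φ (p * z)) (q * φ z) (begin
  φ (p * z) + φ z
    ≡⟨ cong₂ _+_ (φ≡∑coprime (p * z)) (sym multiples-coprime) ⟩
  ∑[ i < p * z ] 𝟙 (coprime? (suc i) (p * z)) + ∑[ i < p * z ] (𝟙 (p ∣? suc i) * 𝟙 (coprime? (suc i) z))
    ≡⟨ ∑-distrib-+ (p * z) _ _ ⟨
  ∑[ i < p * z ] (𝟙 (coprime? (suc i) (p * z)) + 𝟙 (p ∣? suc i) * 𝟙 (coprime? (suc i) z))
    ≡⟨ ∑-cong (p * z) (λ i _ → coprime-prime*-split p-prime p∤z (suc i)) ⟩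
  ∑[ i < p * z ] 𝟙 (coprime? (suc i) z)
    ≡⟨ ∑coprime-periodic p z ⟩
  p * φ z
    ≡⟨ +-comm (φ z) (q * φ z) ⟩
  q * φ z + φ z ∎)
  where
  open ≡-Reasoning
  p = suc q
  z⊥p : Coprime z p
  z⊥p = Coprime.sym (prime∤⇒coprime p-prime p∤z)
  multiples-coprime : ∑[ i < p * z ] (𝟙 (p ∣? suc i) * 𝟙 (coprime? (suc i) z)) ≡ φ z
  multiples-coprime = begin
    ∑[ i < p * z ] (𝟙 (p ∣? suc i) * 𝟙 (coprime? (suc i) z))
      ≡⟨ cong (λ n → ∑[ i < n ] (𝟙 (p ∣? suc i) * 𝟙 (coprime? (suc i) z))) (*-comm p z) ⟩
    ∑[ i < z * p ] (𝟙 (p ∣? suc i) * 𝟙 (coprime? (suc i) z))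
      ≡⟨ ∑-multiples q (λ a → 𝟙 (coprime? a z)) z ⟩
    ∑[ j < z ] 𝟙 (coprime? (suc j * p) z)
      ≡⟨ ∑-cong z (λ j _ → 𝟙-cong (drop-p {suc j}) (add-p {suc j}) _ _) ⟩
    ∑[ j < z ] 𝟙 (coprime? (suc j) z)
      ≡⟨ φ≡∑coprime z ⟨
    φ z ∎
    where
    drop-p : ∀ {a} → Coprime (a * p) z → Coprime a z
    drop-p ap⊥z (i∣a , i∣z) = ap⊥z (∣-trans i∣a (m∣m*n p) , i∣z)
    add-p : ∀ {a} → Coprime a z → Coprime (a * p) z
    add-p a⊥z = Coprime.sym (coprime-*ʳ (Coprime.sym a⊥z) z⊥p)

φ-prime^* : ∀ q k w → Prime (suc q) → suc q ∤ w → φ (suc q ^ suc k * w) ≡ suc q ^ k * (q * φ w)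
φ-prime^* q zero w p-prime p∤w = begin
  φ (suc q * 1 * w)  ≡⟨ cong (λ n → φ (n * w)) (*-identityʳ (suc q)) ⟩
  φ (suc q * w)      ≡⟨ φ-prime* q w p-prime p∤w ⟩
  q * φ w            ≡⟨ *-identityˡ (q * φ w) ⟨
  1 * (q * φ w)      ∎
  where open ≡-Reasoning
φ-prime^* q (suc k) w p-prime p∤w = begin
  φ (p * p ^ suc k * w)      ≡⟨ cong φ (*-assoc p (p ^ suc k) w) ⟩
  φ (p * (p ^ suc k * w))    ≡⟨ φ-*-∣ p _ (∣m⇒∣m*n w (∣m⇒∣m*n (p ^ k) ∣-refl)) ⟩
  p * φ (p ^ suc k * w)      ≡⟨ cong (p *_) (φ-prime^* q k w p-prime p∤w) ⟩
  p * (p ^ k * (q * φ w))    ≡⟨ *-assoc p (p ^ k) _ ⟨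
  p * p ^ k * (q * φ w)      ∎
  where
  open ≡-Reasoning
  p = suc q

∣φ⇒∣φ-prime^* : ∀ {m} q k w → Prime (suc q) → suc q ∤ w → m ∣ φ w → q * m ∣ φ (suc q ^ suc k * w)
∣φ⇒∣φ-prime^* q k w p-prime p∤w m∣φw =
  subst (_ ∣_) (sym (φ-prime^* q k w p-prime p∤w)) (∣n⇒∣m*n (suc q ^ k) (*-monoʳ-∣ q m∣φw))

∣φ-prime^*⇒∣φ : ∀ {m} q k w → Prime (suc q) → suc q ∤ w → Coprime m (suc q) → Coprime m q →
                m ∣ φ (suc q ^ suc k * w) → m ∣ φ w
∣φ-prime^*⇒∣φ q k w p-prime p∤w m⊥p m⊥q m∣φx =
  coprime-divisor (coprime-*ʳ (coprime-^ʳ m⊥p k) m⊥q)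
    (subst (_ ∣_) (trans (φ-prime^* q k w p-prime p∤w) (sym (*-assoc (suc q ^ k) q (φ w)))) m∣φx)

record RatioAtMost (a b x : ℕ) : Set where
  constructor ratio≤
  field
    bx≤aφx : b * x ≤ a * φ x

ratio-weaken : ∀ {a b c d x} .{{_ : NonZero b}} → {True (a * d ≤? c * b)} → RatioAtMost a b x → RatioAtMost c d x
ratio-weaken {a} {b} {c} {d} {x} {ad≤cb} (ratio≤ bx≤aφx) = ratio≤ (*-cancelˡ-≤ b (begin
  b * (d * x)    ≡⟨ x*[y*z]≡y*[x*z] b d x ⟩
  d * (b * x)    ≤⟨ *-monoʳ-≤ d bx≤aφx ⟩
  d * (a * φ x)  ≡⟨ x*[y*z]≡[y*x]*z d a (φ x) ⟩
  (a * d) * φ x  ≤⟨ *-monoˡ-≤ (φ x) (toWitness ad≤cb) ⟩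
  (c * b) * φ x  ≡⟨ [x*y]*z≡y*[x*z] c b (φ x) ⟩
  b * (c * φ x)  ∎))
  where
  open ≤-Reasoning
  x*[y*z]≡y*[x*z] : ∀ x y z → x * (y * z) ≡ y * (x * z)
  x*[y*z]≡y*[x*z] = solve-∀
  x*[y*z]≡[y*x]*z : ∀ x y z → x * (y * z) ≡ (y * x) * z
  x*[y*z]≡[y*x]*z = solve-∀
  [x*y]*z≡y*[x*z] : ∀ x y z → (x * y) * z ≡ y * (x * z)
  [x*y]*z≡y*[x*z] = solve-∀

ratio-* : ∀ {a b c d p q z} → φ (p * z) ≡ q * φ z → d * p ≤ c * q →
          RatioAtMost a b z → RatioAtMost (c * a) (d * b) (p * z)
ratio-* {a} {b} {c} {d} {p} {q} {z} φpz≡qφz dp≤cq (ratio≤ bz≤aφz) = ratio≤ (begin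
  d * b * (p * z)      ≡⟨ rearrange d b p z ⟩
  (d * p) * (b * z)    ≤⟨ *-mono-≤ dp≤cq bz≤aφz ⟩
  (c * q) * (a * φ z)  ≡⟨ rearrange c a q (φ z) ⟨
  c * a * (q * φ z)    ≡⟨ cong (c * a *_) φpz≡qφz ⟨
  c * a * φ (p * z)    ∎)
  where
  open ≤-Reasoning
  rearrange : ∀ x y z w → x * y * (z * w) ≡ (x * z) * (y * w)
  rearrange = solve-∀

ratio-prime^* : ∀ {a b} q k w → Prime (suc q) → suc q ∤ w →
                RatioAtMost a b w → RatioAtMost (suc q * a) (q * b) (suc q ^ suc k * w)
ratio-prime^* {a} {b} q k w p-prime p∤w (ratio≤ bw≤aφw) = ratio≤ (begin
  q * b * (p * P * w)      ≡⟨ left p P q b w ⟩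
  (p * P * q) * (b * w)    ≤⟨ *-monoʳ-≤ (p * P * q) bw≤aφw ⟩
  (p * P * q) * (a * φ w)  ≡⟨ right p P q a (φ w) ⟩
  p * a * (P * (q * φ w))  ≡⟨ cong (p * a *_) (φ-prime^* q k w p-prime p∤w) ⟨
  p * a * φ (p * P * w)    ∎)
  where
  open ≤-Reasoning
  p = suc q
  P = suc q ^ k
  left : ∀ p P q b w → q * b * (p * P * w) ≡ (p * P * q) * (b * w)
  left = solve-∀
  right : ∀ p P q a f → (p * P * q) * (a * f) ≡ p * a * (P * (q * f))
  right = solve-∀

-- Numbers without prime factors below 7

-- 7/6 · 33/35 = 11/10 and 7/6 · (33/35)² ≥ 51/50 are the bounds on p/(p−1) for 10 ∣ p − 1 and 50 ∣ p − 1.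
RoughBudget : ℕ → Set
RoughBudget w = ∀ t s → s ≤ 2 → 2 ^ suc t ∤ φ w → 5 ^ s ∣ φ w →
                RatioAtMost (7 ^ t * 33 ^ s) (6 ^ t * 35 ^ s) w

budget-1 : RoughBudget 1
budget-1 t zero    _ _ _     = ratio≤ (*-monoˡ-≤ 1 (*-monoˡ-≤ 1 (^-monoˡ-≤ t (n≤1+n 6))))
budget-1 t (suc s) _ _ 5^s∣1 = contradiction (∣-trans (m∣m*n (5 ^ s)) 5^s∣1) (from-no (5 ∣? 1))

budget-*-∣ : ∀ {p z} → 5 ∤ p → p ∣ z → RoughBudget z → RoughBudget (p * z)
budget-*-∣ {p} {z} 5∤p p∣z budget t s s≤2 2^t+1∤φpz 5^s∣φpz = ratio≤ (begin
  K * (p * z)    ≡⟨ x*[y*z]≡y*[x*z] K p z ⟩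
  p * (K * z)    ≤⟨ *-monoʳ-≤ p (RatioAtMost.bx≤aφx (budget t s s≤2 2^t+1∤φz 5^s∣φz)) ⟩
  p * (L * φ z)  ≡⟨ x*[y*z]≡y*[x*z] p L (φ z) ⟩
  L * (p * φ z)  ≡⟨ cong (L *_) φpz≡pφz ⟨
  L * φ (p * z)  ∎)
  where
  open ≤-Reasoning
  K = 6 ^ t * 35 ^ s
  L = 7 ^ t * 33 ^ s
  x*[y*z]≡y*[x*z] : ∀ x y z → x * (y * z) ≡ y * (x * z)
  x*[y*z]≡y*[x*z] = solve-∀
  φpz≡pφz : φ (p * z) ≡ p * φ z
  φpz≡pφz = φ-*-∣ p z p∣z
  2^t+1∤φz : 2 ^ suc t ∤ φ z
  2^t+1∤φz 2^t+1∣φz = 2^t+1∤φpz (subst (_ ∣_) (sym φpz≡pφz) (∣n⇒∣m*n p 2^t+1∣φz))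
  5^s∣φz : 5 ^ s ∣ φ z
  5^s∣φz = coprime-divisor (prime∤⇒coprime-^ prime[5] 5∤p s)
                           (subst (_ ∣_) φpz≡pφz 5^s∣φpz)

suc-ratio≤ : ∀ q₀ {q} U D → q₀ ≤ q → {True (U ≤? q₀ * D)} → U * suc q ≤ (U + D) * q
suc-ratio≤ q₀ {q} U D q₀≤q {U≤q₀D} = begin
  U * suc q          ≡⟨ *-suc U q ⟩
  U + U * q          ≤⟨ +-monoˡ-≤ (U * q) (≤-trans (toWitness U≤q₀D) (*-monoˡ-≤ D q₀≤q)) ⟩
  q * D + U * q      ≡⟨ cong (_+ U * q) (*-comm q D) ⟩
  D * q + U * q      ≡⟨ +-comm (D * q) (U * q) ⟩
  U * q + D * q      ≡⟨ *-distribʳ-+ q U D ⟨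
  (U + D) * q        ∎
  where open ≤-Reasoning

budget-step : ∀ {p q z} t s u k → φ (p * z) ≡ q * φ z → 6 ^ u * 35 ^ k * p ≤ 7 ^ u * 33 ^ k * q →
              RatioAtMost (7 ^ t * 33 ^ s) (6 ^ t * 35 ^ s) z →
              RatioAtMost (7 ^ (u + t) * 33 ^ (k + s)) (6 ^ (u + t) * 35 ^ (k + s)) (p * z)
budget-step {p} {q} {z} t s u k φpz≡qφz dp≤cq bound =
  subst₂ (λ a b → RatioAtMost a b (p * z)) (sym (^-split 7 33)) (sym (^-split 6 35))
    (ratio-* {c = 7 ^ u * 33 ^ k} {6 ^ u * 35 ^ k} {p} φpz≡qφz dp≤cq bound)
  where
  ^-split : ∀ m n → m ^ (u + t) * n ^ (k + s) ≡ (m ^ u * n ^ k) * (m ^ t * n ^ s)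
  ^-split m n = trans (cong₂ _*_ (^-distribˡ-+-* m u t) (^-distribˡ-+-* n k s))
                      (rearrange (m ^ u) (m ^ t) (n ^ k) (n ^ s))
    where
    rearrange : ∀ a b c d → a * b * (c * d) ≡ a * c * (b * d)
    rearrange = solve-∀

budget-even-φ-factor : ∀ {q z} → 6 ≤ q → 2 ∣ q → φ (suc q * z) ≡ q * φ z → RoughBudget z →
                       ∀ t s → s ≤ 2 → 2 ^ suc t ∤ q * φ z → 5 ^ s ∣ q * φ z →
                       RatioAtMost (7 ^ t * 33 ^ s) (6 ^ t * 35 ^ s) (suc q * z)
budget-even-φ-factor _ 2∣q _ _ 0 _ _ 2∤qφz _ = contradiction (∣m⇒∣m*n _ 2∣q) 2∤qφz
budget-even-φ-factor {q} {z} 6≤q 2∣q φpz≡qφz budget (suc t) s s≤2 2^t+2∤qφz 5^s∣qφz =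
  charge s s≤2 5^s∣qφz (5 ∣? q)
  where
  step : ∀ s u k → 6 ^ u * 35 ^ k * suc q ≤ 7 ^ u * 33 ^ k * q →
         RatioAtMost (7 ^ t * 33 ^ s) (6 ^ t * 35 ^ s) z →
         RatioAtMost (7 ^ (u + t) * 33 ^ (k + s)) (6 ^ (u + t) * 35 ^ (k + s)) (suc q * z)
  step s u k = budget-step t s u k φpz≡qφz
  bound : ∀ s → s ≤ 2 → 5 ^ s ∣ φ z → RatioAtMost (7 ^ t * 33 ^ s) (6 ^ t * 35 ^ s) z
  bound s s≤2 = budget t s s≤2 (λ 2^t+1∣φz → 2^t+2∤qφz (*-pres-∣ 2∣q 2^t+1∣φz))
  10≤q : 5 ∣ q → 10 ≤ q
  10≤q = 6≤n∧5∣n⇒10≤n 6≤q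
  -- p = q + 1 is charged one factor 2 of φ, plus the factors 5 of q that φ z need not supply.
  charge : ∀ s → s ≤ 2 → 5 ^ s ∣ q * φ z → Dec (5 ∣ q) →
         RatioAtMost (7 ^ suc t * 33 ^ s) (6 ^ suc t * 35 ^ s) (suc q * z)
  charge s s≤2 5^s∣qφz (no 5∤q) = step s 1 0 (suc-ratio≤ 6 6 1 6≤q)
    (bound s s≤2 (coprime-divisor (prime∤⇒coprime-^ prime[5] 5∤q s) 5^s∣qφz))
  charge 0 _ _ (yes _) = step 0 1 0 (suc-ratio≤ 6 6 1 6≤q) (bound 0 z≤n (1∣ φ z))
  charge 1 _ _ (yes 5∣q) = step 0 1 1 (suc-ratio≤ 10 210 21 (10≤q 5∣q)) (bound 0 z≤n (1∣ φ z))
  charge 2 _ 25∣qφz (yes 5∣q) with 25 ∣? q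
  ... | no 25∤q = step 1 1 1 (suc-ratio≤ 10 210 21 (10≤q 5∣q))
                    (bound 1 (s≤s z≤n) (prime-square∣*⇒∣ prime[5] 5∣q 25∤q 25∣qφz))
  ... | yes 25∣q = step 0 1 2 (suc-ratio≤ 50 7350 273 (6≤n∧2∣n∧25∣n⇒50≤n 6≤q 2∣q 25∣q))
                    (bound 0 z≤n (1∣ φ z))
  charge (suc (suc (suc _))) (s≤s (s≤s ())) _ _

budget-prime-∤ : ∀ {p z} → Prime p → 7 ≤ p → 2 ∤ p → p ∤ z → RoughBudget z → RoughBudget (p * z)
budget-prime-∤ {suc q} {z} p-prime (s≤s 6≤q) 2∤p p∤z budget t s s≤2 2^t+1∤φpz 5^s∣φpz =
  budget-even-φ-factor 6≤q 2∣q φpz≡qφz budget t s s≤2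
    (subst (2 ^ suc t ∤_) φpz≡qφz 2^t+1∤φpz) (subst (5 ^ s ∣_) φpz≡qφz 5^s∣φpz)
  where
  φpz≡qφz : φ (suc q * z) ≡ q * φ z
  φpz≡qφz = φ-prime* q z p-prime p∤z
  2∣q : 2 ∣ q
  2∣q with 2∣n⊎2∣1+n q
  ... | inj₁ 2∣q = 2∣q
  ... | inj₂ 2∣p = contradiction 2∣p 2∤p

rough⇒budget : ∀ w .{{_ : NonZero w}} → 7 Rough w → RoughBudget w
rough⇒budget w w-rough with factorise w
... | record { factors = ps ; isFactorisation = refl ; factorsPrime = ps-prime } = go ps ps-prime w-rough
  where
  go : ∀ ps → All Prime ps → 7 Rough product ps → RoughBudget (product ps)
  go []       []                   _        = budget-1
  go (p ∷ ps) (p-prime ∷ ps-prime) pz-rough = step (p ∣? product ps) (go ps ps-prime z-rough)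
    where
    p-rough : 7 Rough p
    p-rough = rough∧∣⇒rough pz-rough (m∣m*n (product ps))
    z-rough : 7 Rough product ps
    z-rough = rough∧∣⇒rough pz-rough (n∣m*n p)
    step : Dec (p ∣ product ps) → RoughBudget (product ps) → RoughBudget (p * product ps)
    step (yes p∣z) = budget-*-∣ (rough⇒∤ p-rough (from-yes (5 <? 7))) p∣z
    step (no p∤z)  = budget-prime-∤ p-prime (rough⇒≤ {{prime⇒nonTrivial p-prime}} p-rough)
                                    (rough⇒∤ p-rough (from-yes (2 <? 7))) p∤z

-- Peeling off the primes 5, 3 and 2

ratio-5-rough : ∀ v .{{_ : NonZero v}} → 5 Rough v → 25 ∣ φ v →
                (8 ∤ φ v → RatioAtMost 5 4 v) × (16 ∤ φ v → RatioAtMost 15 8 v)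
ratio-5-rough v v-rough 25∣φv with prime-power-split prime[5] v
... | inj₁ 5∤v = (λ 8∤φv → ratio-weaken (budget 2 2 ≤-refl 8∤φv 25∣φv))
               , (λ 16∤φv → ratio-weaken (budget 3 2 ≤-refl 16∤φv 25∣φv))
  where
  budget : RoughBudget v
  budget = rough⇒budget v (5-rough⇒7-rough v-rough 5∤v)
... | inj₂ (c , w , refl , 5∤w) =
    (λ 8∤φv → ratio-prime^* 4 c w prime[5] 5∤w (budget 0 0 z≤n (8∤φv ∘ ∣φw⇒∣φv) (1∣ φ w)))
  , (λ 16∤φv → ratio-weaken (ratio-prime^* 4 c w prime[5] 5∤w (budget 1 0 z≤n (16∤φv ∘ ∣φw⇒∣φv) (1∣ φ w))))
  where
  instance
    w≢0 : NonZero w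
    w≢0 = m*n≢0⇒n≢0 (5 ^ suc c)
  ∣φw⇒∣φv : ∀ {m} → m ∣ φ w → 4 * m ∣ φ (5 ^ suc c * w)
  ∣φw⇒∣φv = ∣φ⇒∣φ-prime^* 4 c w prime[5] 5∤w
  budget : RoughBudget w
  budget = rough⇒budget w (5-rough⇒7-rough (rough∧∣⇒rough v-rough (n∣m*n (5 ^ suc c))) 5∤w)

ratio-3-rough : ∀ y .{{_ : NonZero y}} → 3 Rough y → 25 ∣ φ y → 16 ∤ φ y → RatioAtMost 15 8 y
ratio-3-rough y y-rough 25∣φy 16∤φy with prime-power-split prime[3] y
... | inj₁ 3∤y = proj₂ (ratio-5-rough y (3-rough⇒5-rough y-rough 3∤y) 25∣φy) 16∤φy
... | inj₂ (b , v , refl , 3∤v) =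
  ratio-prime^* 2 b v prime[3] 3∤v
    (proj₁ (ratio-5-rough v v-rough 25∣φv) (16∤φy ∘ ∣φ⇒∣φ-prime^* 2 b v prime[3] 3∤v))
  where
  instance
    v≢0 : NonZero v
    v≢0 = m*n≢0⇒n≢0 (3 ^ suc b)
  v-rough : 5 Rough v
  v-rough = 3-rough⇒5-rough (rough∧∣⇒rough y-rough (n∣m*n (3 ^ suc b))) 3∤v
  25∣φv : 25 ∣ φ v
  25∣φv = ∣φ-prime^*⇒∣φ 2 b v prime[3] 3∤v (from-yes (coprime? 25 3)) (from-yes (coprime? 25 2)) 25∣φy

ratio-bound : ∀ x .{{_ : NonZero x}} → 25 ∣ φ x → 16 ∤ φ x → RatioAtMost 15 4 x
ratio-bound x 25∣φx 16∤φx with prime-power-split prime[2] x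
... | inj₁ 2∤x = ratio-weaken (ratio-3-rough x (∤⇒rough-suc 2∤x 2-rough) 25∣φx 16∤φx)
... | inj₂ (a , y , refl , 2∤y) =
  ratio-weaken (ratio-prime^* 1 a y prime[2] 2∤y (ratio-3-rough y (∤⇒rough-suc 2∤y 2-rough) 25∣φy 16∤φy))
  where
  instance
    y≢0 : NonZero y
    y≢0 = m*n≢0⇒n≢0 (2 ^ suc a)
  25∣φy : 25 ∣ φ y
  25∣φy = ∣φ-prime^*⇒∣φ 1 a y prime[2] 2∤y (from-yes (coprime? 25 2)) (from-yes (coprime? 25 1)) 25∣φx
  16∤φy : 16 ∤ φ y
  16∤φy = 16∤φx ∘ ∣φ⇒∣φ-prime^* 1 a y prime[2] 2∤y

φ[2*3^a+1*5^c+1] : ∀ a c → φ (2 * 3 ^ suc a * 5 ^ suc c) ≡ 8 * (3 ^ a * 5 ^ c)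
φ[2*3^a+1*5^c+1] a c = begin
  φ (2 * 3 ^ suc a * 5 ^ suc c)      ≡⟨ cong φ (x*y*z≡z*[y*x] 2 (3 ^ suc a) (5 ^ suc c)) ⟩
  φ (5 ^ suc c * (3 ^ suc a * 2))    ≡⟨ φ-prime^* 4 c _ prime[5] 5∤3^a+1*2 ⟩
  5 ^ c * (4 * φ (3 ^ suc a * 2))    ≡⟨ cong (λ n → 5 ^ c * (4 * n))
                                             (φ-prime^* 2 a 2 prime[3] (from-no (3 ∣? 2))) ⟩
  5 ^ c * (4 * (3 ^ a * (2 * 1)))    ≡⟨ collect (3 ^ a) (5 ^ c) ⟩
  8 * (3 ^ a * 5 ^ c)                ∎
  where
  open ≡-Reasoning
  x*y*z≡z*[y*x] : ∀ x y z → x * y * z ≡ z * (y * x)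
  x*y*z≡z*[y*x] = solve-∀
  collect : ∀ A B → B * (4 * (A * (2 * 1))) ≡ 8 * (A * B)
  collect = solve-∀
  5∤3^a+1*2 : 5 ∤ 3 ^ suc a * 2
  5∤3^a+1*2 5∣3^a+1*2 with euclidsLemma (3 ^ suc a) 2 prime[5] 5∣3^a+1*2
  ... | inj₁ 5∣3^a+1 = prime∤⇒∤^ prime[5] (from-no (5 ∣? 3)) (suc a) 5∣3^a+1
  ... | inj₂ 5∣2     = from-no (5 ∣? 2) 5∣2

16∤8*3^a*5^c : ∀ a c → 16 ∤ 8 * (3 ^ a * 5 ^ c)
16∤8*3^a*5^c a c 16∣8M with euclidsLemma (3 ^ a) (5 ^ c) prime[2] (*-cancelˡ-∣ 8 16∣8M)
... | inj₁ 2∣3^a = prime∤⇒∤^ prime[2] (from-no (2 ∣? 3)) a 2∣3^a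
... | inj₂ 2∣5^c = prime∤⇒∤^ prime[2] (from-no (2 ∣? 5)) c 2∣5^c

N₂[2*3^a+1*5^b+3] : ∀ a b → InN₂ (2 * 3 ^ suc a * 5 ^ (3 + b))
N₂[2*3^a+1*5^b+3] a b = φ N , (N , N≥1 , refl) , N≥1 , refl , maximal
  where
  N = 2 * 3 ^ suc a * 5 ^ (3 + b)
  M = 3 ^ a * 5 ^ (2 + b)
  φN≡8M : φ N ≡ 8 * M
  φN≡8M = φ[2*3^a+1*5^c+1] a (2 + b)
  N≥1 : 1 ≤ N
  N≥1 = *-mono-≤ (*-mono-≤ (s≤s (z≤n {1})) (m^n>0 3 (suc a))) (m^n>0 5 (3 + b))
  16∤8M : 16 ∤ 8 * M
  16∤8M = 16∤8*3^a*5^c a (2 + b)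
  5*[5*B]≡B*25 : ∀ B → 5 * (5 * B) ≡ B * 25
  5*[5*B]≡B*25 = solve-∀
  25∣8M : 25 ∣ 8 * M
  25∣8M = ∣n⇒∣m*n 8 (∣n⇒∣m*n (3 ^ a) (divides (5 ^ b) (5*[5*B]≡B*25 (5 ^ b))))
  maximal : ∀ x → IsPos x → φ x ≡ φ N → x ≤ N
  maximal x x≥1 φx≡φN = *-cancelˡ-≤ 4 (begin
    4 * x        ≤⟨ RatioAtMost.bx≤aφx (ratio-bound x {{>-nonZero x≥1}} 25∣φx 16∤φx) ⟩
    15 * φ x     ≡⟨ cong (15 *_) φx≡8M ⟩
    15 * (8 * M) ≡⟨ 15*[8*M]≡4*N (3 ^ a) (5 ^ (2 + b)) ⟩
    4 * N        ∎)
    where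
    open ≤-Reasoning
    φx≡8M : φ x ≡ 8 * M
    φx≡8M = trans φx≡φN φN≡8M
    25∣φx : 25 ∣ φ x
    25∣φx = subst (25 ∣_) (sym φx≡8M) 25∣8M
    16∤φx : 16 ∤ φ x
    16∤φx = 16∤8M ∘ subst (16 ∣_) φx≡8M
    15*[8*M]≡4*N : ∀ A B → 15 * (8 * (A * B)) ≡ 4 * (2 * (3 * A) * (5 * B))
    15*[8*M]≡4*N = solve-∀

proposition3p13 : ∀ (r₁ r₂ : ℕ) → r₁ ≥ 1 → r₂ > 2 → InN₂ (2 * 3 ^ r₁ * 5 ^ r₂)
proposition3p13 (suc a) (suc (suc (suc b))) _ _ = N₂[2*3^a+1*5^b+3] a b
proposition3p13 (suc a) 1                   _ (s≤s ())
proposition3p13 (suc a) 2                   _ (s≤s (s≤s ()))
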